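{- For each $k$, the map $f:\mathcal{R}^0_{n,k}\to\widetilde{\mathfrak{D}}_{n,k}$ defined by $f(\sigma)=\varphi'_{x}(\sigma)$ with $x=\beta_1(\sigma)$ is well defined (takes values in $\widetilde{\mathfrak{D}}_{n,k}$) and is a bijection.
   Context: For $\sigma=\sigma_1\cdots\sigma_n\in\mathfrak{S}_n$, with $\sigma_0=\sigma_{n+1}=+\infty$: $\sigma_i$ is a double descent / double ascent / peak / valley if $\sigma_{i-1}>\sigma_i>\sigma_{i+1}$ / $\sigma_{i-1}<\sigma_i<\sigma_{i+1}$ / $\sigma_{i-1}<\sigma_i>\sigma_{i+1}$ / $\sigma_{i-1}>\sigma_i<\sigma_{i+1}$; $\mathrm{dd}(\sigma)$ is the number of double descents; $\mathrm{des}(\sigma)=|\{i\in[n-1]:\sigma_i>\sigma_{i+1}\}|$. For $x\in[n]$ write $\sigma=w_1w_2xw_3w_4$ where $w_2$ (resp. $w_3$) is the maximal contiguous subword immediately left (resp. right) of $x$ with all letters smaller than $x$; $\varphi'_x(\sigma)=w_1w_3xw_2w_4$ if $x$ is a double ascent or double descent, and $\varphi'_x(\sigma)=\sigma$ if $x$ is a peak or valley. Words have distinct letters; $w_i$ is a descent top if $w_i>w_{i+1}$; a length-1 word is an L-hook; a word of length $\ge2$ is an L-hook (resp. F-hook) if its last (resp. first) letter is its greatest. The rix-factorization $\sigma=\alpha_1\cdots\alpha_i\beta$ is produced by: $w\leftarrow\sigma$, $i\leftarrow0$; if $w$ is increasing, $\beta=w$, stop; else $i\leftarrow i+1$, $x$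 = greatest descent top of $w$, $w=w'xw''$; if $w'$ empty, $\beta=w$, stop; else $\alpha_i=w'x$, $w\leftarrow w''$, repeat. $\beta_1(\sigma)$ is the first letter of $\beta$. The statistic $\mathrm{rix}$: $\mathrm{rix}(\emptyset)=0$; if $w=w_1\cdots w_k$ has its maximum at position $i$, then $\mathrm{rix}(w)=0$ if $i=1<k$, $=1+\mathrm{rix}(w_1\cdots w_{k-1})$ if $i=k$, $=\mathrm{rix}(w_{i+1}\cdots w_k)$ if $1<i<k$. $\mathcal{R}^0_{n,k}=\{\sigma\in\mathfrak{S}_n:\mathrm{rix}(\sigma)=0,\ \mathrm{dd}(\sigma)=1,\ \mathrm{des}(\sigma)=k\}$; $\mathfrak{D}_{n,k}=\{\sigma:\mathrm{dd}(\sigma)=0,\ \mathrm{des}(\sigma)=k\}$; $\widetilde{\mathfrak{D}}_{n,k}=\{\sigma\in\mathfrak{D}_{n,k-1}:\sigma_{n-1}<\sigma_n\}$. -}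

module Defs where

open import Data.Nat.Base using (ℕ; zero; suc; _+_; _⊔_; _<ᵇ_; _≡ᵇ_)
open import Data.Bool.Base using (Bool; true; false; _∧_; _∨_; not; if_then_else_)
open import Data.List.Base using (List; []; _∷_; _++_; reverse; length; head; applyUpTo; foldr)
open import Data.Maybe.Base using (Maybe; just; nothing; fromMaybe)
open import Data.Product.Base using (_×_; _,_)
open import Relation.Binary.PropositionalEquality using (_≡_)
open import Data.List.Relation.Binary.Permutation.Propositional using (_↭_)

-- Permutations of [n] = {1,…,n}, written in one-line notation as lists.
IsPerm : ℕ → List ℕ → Set
IsPerm n σ = σ ↭ applyUpTo suc n

-- Extended naturals: nothing represents +∞.  ltE a b  ⇔  a < b.
ltE : Maybe ℕ → Maybe ℕ → Bool
ltE (just a) (just b) = a <ᵇ b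
ltE (just _) nothing  = true
ltE nothing  _        = false

-- number of double descents (σ₀ = σ_{n+1} = +∞)
ddGo : Maybe ℕ → List ℕ → ℕ
ddGo p []       = 0
ddGo p (x ∷ xs) =
  (if (ltE (just x) p ∧ ltE (head xs) (just x)) then 1 else 0) + ddGo (just x) xs

dd : List ℕ → ℕ
dd σ = ddGo nothing σ

des : List ℕ → ℕ
des (x ∷ y ∷ xs) = (if y <ᵇ x then 1 else 0) + des (y ∷ xs)
des _            = 0

maxList : List ℕ → ℕ
maxList = foldr _⊔_ 0

breakAt : ℕ → List ℕ → List ℕ × List ℕ
breakAt x [] = [] , []
breakAt x (y ∷ ys) with y ≡ᵇ x
... | true  = [] , ys
... | false with breakAt x ys
...   | a , b = y ∷ a , b

-- the statistic rix (with fuel; length w is sufficient fuel)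
rixCase : (List ℕ → ℕ) → List ℕ → List ℕ → ℕ
rixCase r []      []      = 1 + r []     -- maximum at position 1 = k
rixCase r []      (_ ∷ _) = 0            -- maximum at position 1 < k
rixCase r (a ∷ as) []     = 1 + r (a ∷ as)  -- maximum at position k
rixCase r (_ ∷ _) (b ∷ bs) = r (b ∷ bs)  -- 1 < i < k

rixF : ℕ → List ℕ → ℕ
rixF zero    w       = 0
rixF (suc f) []      = 0
rixF (suc f) (y ∷ ys) with breakAt (maxList (y ∷ ys)) (y ∷ ys)
... | a , b = rixCase (rixF f) a b

rix : List ℕ → ℕ
rix w = rixF (length w) w

increasing : List ℕ → Bool
increasing (x ∷ y ∷ xs) = (x <ᵇ y) ∧ increasing (y ∷ xs)
increasing _            = true

descTops : List ℕ → List ℕ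
descTops (x ∷ y ∷ xs) = if y <ᵇ x then (x ∷ descTops (y ∷ xs)) else descTops (y ∷ xs)
descTops _            = []

-- the final factor β of the rix-factorization (with fuel; length w suffices)
betaStep : (List ℕ → List ℕ) → List ℕ → List ℕ → List ℕ → List ℕ
betaStep r w []      w'' = w
betaStep r w (_ ∷ _) w'' = r w''      -- α_i = w'x, continue with w''

betaF : ℕ → List ℕ → List ℕ
betaF zero    w = w
betaF (suc f) w with increasing w
... | true  = w
... | false with breakAt (maxList (descTops w)) w
...   | w' , w'' = betaStep (betaF f) w w' w''

beta : List ℕ → List ℕ
beta σ = betaF (length σ) σ

-- β₁(σ): first letter of β (β is nonempty whenever σ is)
beta1 : List ℕ → ℕ
beta1 σ = fromMaybe 0 (head (beta σ))

spanLt : ℕ → List ℕ → List ℕ × List ℕ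
spanLt x [] = [] , []
spanLt x (y ∷ ys) with y <ᵇ x
... | false = [] , y ∷ ys
... | true with spanLt x ys
...   | a , b = y ∷ a , b

phiStep : ℕ → List ℕ → List ℕ → List ℕ → List ℕ × List ℕ → List ℕ × List ℕ → List ℕ
phiStep x σ L R (w2r , w1r) (w3 , w4) =
  if (ltE p (just x) ∧ ltE (just x) q) ∨ (ltE (just x) p ∧ ltE q (just x))
  then reverse w1r ++ w3 ++ x ∷ reverse w2r ++ w4
  else σ
  where
  p = head (reverse L)   -- σ_{i-1}, or +∞
  q = head R             -- σ_{i+1}, or +∞

phi' : ℕ → List ℕ → List ℕ
phi' x σ with breakAt x σ
... | L , R = phiStep x σ L R (spanLt x (reverse L)) (spanLt x R)

f : List ℕ → List ℕ
f σ = phi' (beta1 σ) σ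

-- σ_{n-1} < σ_n  (with σ₀ = +∞)
lastAsc : List ℕ → Bool
lastAsc (x ∷ y ∷ []) = x <ᵇ y
lastAsc (x ∷ y ∷ z ∷ xs) = lastAsc (y ∷ z ∷ xs)
lastAsc _ = false

R0 : ℕ → ℕ → List ℕ → Set
R0 n k σ = IsPerm n σ × rix σ ≡ 0 × dd σ ≡ 1 × des σ ≡ k

D : ℕ → ℕ → List ℕ → Set
D n k σ = IsPerm n σ × dd σ ≡ 0 × des σ ≡ k

-- 𝔇̃_{n,k} = {σ ∈ 𝔇_{n,k-1} : σ_{n-1} < σ_n}  (empty when k = 0)
Dt : ℕ → ℕ → List ℕ → Set
Dt n zero    σ = D n zero σ × false ≡ true
Dt n (suc k) σ = D n k σ × lastAsc σ ≡ true

-- A permutation has rix 0 exactly when it factors as σ = P x B with B nonempty, every letter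
-- of B below x, and x below the last letter of P (if any), so that x is a double descent.
-- When x is the only double descent, the rix-factorization ends with β = x B, and φ'_x moves
-- x to the end: f σ = P B x.  This removes one double descent and one descent and leaves a
-- final ascent.  Conversely τ = I x ∈ 𝔇̃ is recovered by splitting I = P B with B the longest
-- suffix below x; B is nonempty because τ ends with an ascent.
module Submission where

open import Defs
open import Data.Bool.Base using (true; false; _∧_; if_then_else_)
open import Data.Bool.Properties using (T-≡; ∧-zeroʳ)
open import Data.Empty using (⊥; ⊥-elim)
open import Data.List.Base
  using (List; []; _∷_; _++_; _ʳ++_; [_]; reverse; length; head; initLast; _∷ʳ′_)
open import Data.List.Properties
  using (++-assoc; ++-identityʳ; reverse-involutive; ∷-injective; ∷ʳ-injective; length-++)
open import Data.List.Membership.Propositional using (_∈_; _∉_)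
open import Data.List.Membership.Propositional.Properties using (∈-++⁺ʳ; ∈-++⁺ˡ; ∈-++⁻; ∈-∃++)
open import Data.List.Relation.Unary.Any using (here; there)
open import Data.List.Relation.Unary.All as All using (All; []; _∷_)
open import Data.List.Relation.Unary.All.Properties using (++⁻ˡ)
open import Data.List.Relation.Unary.AllPairs as AllPairs using (_∷_)
open import Data.List.Relation.Unary.Unique.Propositional using (Unique)
open import Data.List.Relation.Unary.Unique.Propositional.Properties
  using (applyUpTo⁺₁; Unique[x∷xs]⇒x∉xs)
open import Data.List.Relation.Binary.Permutation.Propositional as Perm using (_↭_; ↭-sym; ↭⇒↭ₛ)
open import Data.List.Relation.Binary.Permutation.Propositional.Properties using (++⁺ˡ; ∷↭∷ʳ)
open import Data.Maybe.Base using (Maybe; just; nothing; fromMaybe)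
open import Data.Nat.Base using (ℕ; zero; suc; _+_; _<ᵇ_; _≡ᵇ_; _≤_; _<_; z≤n; s≤s)
open import Data.Nat.Properties
open import Data.Product.Base using (_×_; _,_; ∃; ∃₂)
open import Data.Sum.Base using (_⊎_; inj₁; inj₂)
open import Function.Base using (_∘_)
open import Function.Bundles using (Equivalence)
open import Relation.Nullary using (¬_; yes; no)
open import Relation.Binary.PropositionalEquality
  using (_≡_; refl; sym; trans; cong; cong₂; subst; subst₂; setoid; module ≡-Reasoning)
open import Data.List.Relation.Binary.Permutation.Setoid.Properties (setoid ℕ) using (Unique-resp-↭)

private variable
  m n x : ℕ
  q : Maybe ℕ

<⇒<ᵇ≡true : m < n → (m <ᵇ n) ≡ true
<⇒<ᵇ≡true = Equivalence.to T-≡ ∘ <⇒<ᵇ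

<ᵇ≡true⇒< : ∀ m n → (m <ᵇ n) ≡ true → m < n
<ᵇ≡true⇒< m n = <ᵇ⇒< m n ∘ Equivalence.from T-≡

>⇒<ᵇ≡false : n < m → (m <ᵇ n) ≡ false
>⇒<ᵇ≡false {n} {m} n<m with m <ᵇ n in eq
... | true  = ⊥-elim (<-asym n<m (<ᵇ≡true⇒< m n eq))
... | false = refl

length-suffix-≤ : ∀ {w fuel} u {m : ℕ} {z} → w ≡ u ++ m ∷ z → length w ≤ suc fuel → length z ≤ fuel
length-suffix-≤ u {z = z} refl len =
  ≤-pred (≤-trans (m≤n+m (suc (length z)) (length u)) (subst (_≤ _) (length-++ u) len))

IsPerm⇒Unique : ∀ {σ} → IsPerm n σ → Unique σ
IsPerm⇒Unique {n} σ↭ = Unique-resp-↭ (↭⇒↭ₛ (↭-sym σ↭))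
  (applyUpTo⁺₁ suc n (λ i<j _ → <⇒≢ i<j ∘ suc-injective))

Unique-++⁻ʳ : ∀ u {v : List ℕ} → Unique (u ++ v) → Unique v
Unique-++⁻ʳ []      uv       = uv
Unique-++⁻ʳ (_ ∷ u) (_ ∷ uv) = Unique-++⁻ʳ u uv

Unique-middle∉ˡ : ∀ u {v} → Unique (u ++ m ∷ v) → m ∉ u
Unique-middle∉ˡ (_ ∷ u) (m≢ ∷ _)  (here refl)  = All.lookup m≢ (∈-++⁺ʳ u (here refl)) refl
Unique-middle∉ˡ (_ ∷ u) (_  ∷ uv) (there m∈u) = Unique-middle∉ˡ u uv m∈u

Unique-middle∉ʳ : ∀ u {v} → Unique (u ++ m ∷ v) → m ∉ v
Unique-middle∉ʳ u = Unique[x∷xs]⇒x∉xs ∘ Unique-++⁻ʳ u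

Unique-suffix : ∀ u {v} → Unique (u ++ m ∷ v) → Unique v
Unique-suffix u = AllPairs.tail ∘ Unique-++⁻ʳ u

maxList-ub : ∀ w → All (_≤ maxList w) w
maxList-ub []       = []
maxList-ub (y ∷ ys) =
  m≤m⊔n y (maxList ys) ∷ All.map (λ e≤ → ≤-trans e≤ (m≤n⊔m y (maxList ys))) (maxList-ub ys)

maxList-lub : ∀ w → All (_≤ m) w → maxList w ≤ m
maxList-lub []       []           = z≤n
maxList-lub (y ∷ ys) (y≤ ∷ ys≤) = ⊔-lub y≤ (maxList-lub ys ys≤)

maxList-∈ : ∀ y ys → maxList (y ∷ ys) ∈ y ∷ ys
maxList-∈ y []       = here (⊔-identityʳ y)
maxList-∈ y (z ∷ zs) with ⊔-sel y (maxList (z ∷ zs))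
... | inj₁ e = here e
... | inj₂ e = there (subst (_∈ z ∷ zs) (sym e) (maxList-∈ z zs))

maxList-∷-greatest : ∀ r → All (_< x) r → maxList (x ∷ r) ≡ x
maxList-∷-greatest {x} r r<x = m≥n⇒m⊔n≡m (maxList-lub r (All.map <⇒≤ r<x))

suffix-<-max : ∀ {w} u {z} → w ≡ u ++ m ∷ z → All (_≤ m) w → Unique w → All (_< m) z
suffix-<-max u refl w≤m uw = All.tabulate λ e∈z →
  ≤∧≢⇒< (All.lookup w≤m (∈-++⁺ʳ u (there e∈z)))
        (λ { refl → Unique-middle∉ʳ u uw e∈z })

Below : Maybe ℕ → ℕ → Set
Below p x = ltE (just x) p ≡ true

Below-<-trans : ∀ p → m < n → Below p n → Below p m
Below-<-trans nothing  _   _   = refl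
Below-<-trans {n = n} (just y) m<n n<y = <⇒<ᵇ≡true (<-trans m<n (<ᵇ≡true⇒< n y n<y))

lastOr : Maybe ℕ → List ℕ → Maybe ℕ
lastOr q []       = q
lastOr q (y ∷ ys) = lastOr (just y) ys

lastOr-++ : ∀ q u ys → lastOr q (u ++ ys) ≡ lastOr (lastOr q u) ys
lastOr-++ q []      ys = refl
lastOr-++ q (c ∷ u) ys = lastOr-++ (just c) u ys

lastOr-∈ : ∀ a A → ∃ λ c → lastOr (just a) A ≡ just c × c ∈ a ∷ A
lastOr-∈ a []      = a , refl , here refl
lastOr-∈ a (b ∷ B) with lastOr-∈ b B
... | c , e , c∈ = c , e , there c∈

head-ʳ++ : ∀ P ys → head (P ʳ++ ys) ≡ lastOr (head ys) P
head-ʳ++ []      ys = refl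
head-ʳ++ (y ∷ P) ys = head-ʳ++ P (y ∷ ys)

-- q stands for the letter preceding P, nothing meaning +∞.
BelowLast : Maybe ℕ → List ℕ → ℕ → Set
BelowLast q P x = Below (lastOr q P) x

BelowLast-∷⇒∃> : ∀ y ys → BelowLast q (y ∷ ys) x → ∃ λ c → c ∈ y ∷ ys × x < c
BelowLast-∷⇒∃> {x = x} y ys x<last with lastOr-∈ y ys
... | c , e , c∈ = c , c∈ , <ᵇ≡true⇒< x c (subst (λ t → Below t x) e x<last)

BelowLast⇒¬All< : ∀ y ys → BelowLast q (y ∷ ys) x → ¬ All (_< x) (y ∷ ys)
BelowLast⇒¬All< {q} y ys x<last ys<x with BelowLast-∷⇒∃> {q} y ys x<last
... | c , c∈ , x<c = <-asym (All.lookup ys<x c∈) x<c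

BelowLast-rebase : ∀ P → BelowLast nothing P x → Below q x → BelowLast q P x
BelowLast-rebase []      _      x<q = x<q
BelowLast-rebase (_ ∷ _) x<last _   = x<last

BelowLast⇒Below-head-reverse : ∀ P → BelowLast nothing P x → Below (head (reverse P)) x
BelowLast⇒Below-head-reverse {x} P = subst (λ t → Below t x) (sym (head-ʳ++ P []))

data DescentSplit (σ : List ℕ) : Set where
  split : ∀ P x b B → σ ≡ P ++ x ∷ b ∷ B → All (_< x) (b ∷ B) → BelowLast nothing P x →
          DescentSplit σ

split-unique : ∀ q P P′ (R R′ : List ℕ) → P ++ R ≡ P′ ++ R′ → All (_< x) R → All (_< x) R′ →
               BelowLast q P x → BelowLast q P′ x → P ≡ P′ × R ≡ R′
split-unique q []      []       R R′ R≡R′ _ _ _ _ = refl , R≡R′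
split-unique q []      (y ∷ P′) R R′ refl R<x _ _ x<last′ =
  ⊥-elim (BelowLast⇒¬All< {q} y P′ x<last′ (++⁻ˡ (y ∷ P′) R<x))
split-unique q (y ∷ P) []       R R′ refl _ R′<x x<last _ =
  ⊥-elim (BelowLast⇒¬All< {q} y P x<last (++⁻ˡ (y ∷ P) R′<x))
split-unique q (y ∷ P) (y′ ∷ P′) R R′ eq R<x R′<x x<last x<last′ with ∷-injective eq
... | refl , eq′ with split-unique (just y) P P′ R R′ eq′ R<x R′<x x<last x<last′
... | refl , refl = refl , refl

maximal-suffix< : ∀ x I → x ∉ I → ∃₂ λ P S → I ≡ P ++ S × All (_< x) S × BelowLast nothing P x
maximal-suffix< x []      _   = [] , [] , refl , [] , refl
maximal-suffix< x (y ∷ I) x∉ with maximal-suffix< x I (x∉ ∘ there)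
... | z ∷ P , S , refl , S<x , x<last = y ∷ z ∷ P , S , refl , S<x , x<last
... | []    , S , refl , S<x , _ with y <? x
...   | yes y<x = [] , y ∷ S , refl , y<x ∷ S<x , refl
...   | no  y≮x = y ∷ [] , S , refl , S<x , <⇒<ᵇ≡true (≤∧≢⇒< (≮⇒≥ y≮x) (x∉ ∘ here))

↭-moveToEnd : ∀ P (x b : ℕ) B → P ++ x ∷ b ∷ B ↭ P ++ (b ∷ B) ++ [ x ]
↭-moveToEnd P x b B = ++⁺ˡ P (∷↭∷ʳ x (b ∷ B))

ddGo-∷-doubleDescent : ∀ p x b B → Below p x → b < x →
                       ddGo p (x ∷ b ∷ B) ≡ suc (ddGo (just x) (b ∷ B))
ddGo-∷-doubleDescent p x b B x<p b<x rewrite x<p | <⇒<ᵇ≡true b<x = refl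

-- Only the comparison of the left boundary with the first letter matters.
ddGo-snoc-greater : ∀ q q' x b B → All (_< x) (b ∷ B) → ltE (just b) q ≡ ltE (just b) q' →
                    ddGo q (b ∷ B) ≡ ddGo q' (b ∷ B ++ [ x ])
ddGo-snoc-greater q q' x b []      (b<x ∷ []) b<q
  rewrite b<q | >⇒<ᵇ≡false b<x | ∧-zeroʳ (ltE (just b) q') = refl
ddGo-snoc-greater q q' x b (c ∷ B) (_ ∷ B<x)  b<q rewrite b<q =
  cong ((if ltE (just b) q' ∧ (c <ᵇ b) then 1 else 0) +_) (ddGo-snoc-greater (just b) (just b) x c B B<x refl)

ddGo-split : ∀ p P x b B → All (_< x) (b ∷ B) → BelowLast p P x →
             ddGo p (P ++ x ∷ b ∷ B) ≡ suc (ddGo p (P ++ (b ∷ B) ++ [ x ]))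
ddGo-split p [] x b B B<x@(b<x ∷ _) x<p =
  trans (ddGo-∷-doubleDescent p x b B x<p b<x)
        (cong suc (ddGo-snoc-greater (just x) p x b B B<x
                     (trans (<⇒<ᵇ≡true b<x) (sym (Below-<-trans p b<x x<p)))))
ddGo-split p (y ∷ []) x b B B<x@(b<x ∷ _) x<y =
  trans (cong₂ (λ c t → (if ltE (just y) p ∧ c then 1 else 0) + t)
               (trans x<y (sym (<⇒<ᵇ≡true (<-trans b<x (<ᵇ≡true⇒< x y x<y)))))
               (ddGo-split (just y) [] x b B B<x x<y))
        (+-suc _ _)
ddGo-split p (y ∷ z ∷ P) x b B B<x x<last =
  trans (cong ((if ltE (just y) p ∧ (z <ᵇ y) then 1 else 0) +_) (ddGo-split (just y) (z ∷ P) x b B B<x x<last))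
        (+-suc _ _)

ddGo-split-pos : ∀ p A x b B → All (_< x) (b ∷ B) → BelowLast p A x → 1 ≤ ddGo p (A ++ x ∷ b ∷ B)
ddGo-split-pos p A x b B B<x x<last rewrite ddGo-split p A x b B B<x x<last = s≤s z≤n

ddGo-++-≤ : ∀ p u ys → ddGo (lastOr p u) ys ≤ ddGo p (u ++ ys)
ddGo-++-≤ p []      ys = ≤-refl
ddGo-++-≤ p (c ∷ u) ys = ≤-trans (ddGo-++-≤ (just c) u ys) (m≤n+m _ _)

ddGo-suffix-≤ : ∀ p u m z → ddGo (just m) z ≤ ddGo p (u ++ m ∷ z)
ddGo-suffix-≤ p u m z = ≤-trans (m≤n+m _ _) (ddGo-++-≤ p u (m ∷ z))

ddGo-two-doubleDescents : ∀ p m A x b B → Below p m → All (_< m) (A ++ x ∷ b ∷ B) →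
                          All (_< x) (b ∷ B) → BelowLast (just m) A x → 2 ≤ ddGo p (m ∷ A ++ x ∷ b ∷ B)
ddGo-two-doubleDescents p m [] x b B m<p (x<m ∷ _) B<x x<m′
  rewrite ddGo-∷-doubleDescent p m x (b ∷ B) m<p x<m | ddGo-split (just m) [] x b B B<x x<m′ =
  s≤s (s≤s z≤n)
ddGo-two-doubleDescents p m (a ∷ A) x b B m<p (a<m ∷ _) B<x x<last
  rewrite ddGo-∷-doubleDescent p m a (A ++ x ∷ b ∷ B) m<p a<m | ddGo-split (just m) (a ∷ A) x b B B<x x<last =
  s≤s (s≤s z≤n)

des-snoc-greater : ∀ x b B → All (_< x) (b ∷ B) → des (b ∷ B ++ [ x ]) ≡ des (b ∷ B)
des-snoc-greater x b []      (b<x ∷ []) rewrite >⇒<ᵇ≡false b<x = refl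
des-snoc-greater x b (c ∷ B) (_ ∷ B<x)  = cong ((if c <ᵇ b then 1 else 0) +_) (des-snoc-greater x c B B<x)

des-split : ∀ q P x b B → All (_< x) (b ∷ B) → BelowLast q P x →
            des (P ++ x ∷ b ∷ B) ≡ suc (des (P ++ (b ∷ B) ++ [ x ]))
des-split q [] x b B B<x@(b<x ∷ _) _ rewrite <⇒<ᵇ≡true b<x = cong suc (sym (des-snoc-greater x b B B<x))
des-split q (y ∷ []) x b B B<x@(b<x ∷ _) x<y =
  trans (cong₂ (λ c t → (if c then 1 else 0) + t)
               (trans x<y (sym (<⇒<ᵇ≡true (<-trans b<x (<ᵇ≡true⇒< x y x<y)))))
               (des-split (just y) [] x b B B<x x<y))
        (+-suc _ _)
des-split q (y ∷ z ∷ P) x b B B<x x<last =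
  trans (cong ((if z <ᵇ y then 1 else 0) +_) (des-split q (z ∷ P) x b B B<x x<last)) (+-suc _ _)

lastAsc-snoc : ∀ x c L {d} → lastOr (just c) L ≡ just d → lastAsc (c ∷ L ++ [ x ]) ≡ (d <ᵇ x)
lastAsc-snoc x c []          refl = refl
lastAsc-snoc x c (e ∷ [])    last≡d = lastAsc-snoc x e [] last≡d
lastAsc-snoc x c (e ∷ g ∷ L) last≡d = lastAsc-snoc x e (g ∷ L) last≡d

lastAsc-split : ∀ P x b B → All (_< x) (b ∷ B) → lastAsc (P ++ (b ∷ B) ++ [ x ]) ≡ true
lastAsc-split P x b B B<x with lastOr-∈ b B
... | d , last≡d , d∈ = trans (cong lastAsc (sym (++-assoc P (b ∷ B) [ x ]))) (lastAsc≡true P)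
  where
  d<x : (d <ᵇ x) ≡ true
  d<x = <⇒<ᵇ≡true (All.lookup B<x d∈)
  lastAsc≡true : ∀ P → lastAsc ((P ++ b ∷ B) ++ [ x ]) ≡ true
  lastAsc≡true []      = trans (lastAsc-snoc x b B last≡d) d<x
  lastAsc≡true (a ∷ P) =
    trans (lastAsc-snoc x a (P ++ b ∷ B) (trans (lastOr-++ (just a) P (b ∷ B)) last≡d)) d<x

lastAsc-snoc-BelowLast-⊥ : ∀ P → lastAsc (P ++ [ x ]) ≡ true → BelowLast nothing P x → ⊥
lastAsc-snoc-BelowLast-⊥ []      ()
lastAsc-snoc-BelowLast-⊥ {x} (a ∷ P) asc x<last with lastOr-∈ a P
... | d , last≡d , _ =
  <-asym (<ᵇ≡true⇒< d x (trans (sym (lastAsc-snoc x a P last≡d)) asc))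
         (<ᵇ≡true⇒< x d (subst (λ t → Below t x) last≡d x<last))

increasing-descent : ∀ A x b B → b < x → increasing (A ++ x ∷ b ∷ B) ≡ false
increasing-descent []          x b B b<x rewrite >⇒<ᵇ≡false b<x = refl
increasing-descent (y ∷ [])    x b B b<x rewrite increasing-descent [] x b B b<x = ∧-zeroʳ _
increasing-descent (y ∷ z ∷ A) x b B b<x rewrite increasing-descent (z ∷ A) x b B b<x = ∧-zeroʳ _

breakAt-++ : ∀ x u t → x ∉ u → breakAt x (u ++ x ∷ t) ≡ (u , t)
breakAt-++ x []      t _ rewrite Equivalence.to T-≡ (≡⇒≡ᵇ x x refl) = refl
breakAt-++ x (c ∷ u) t x∉ with c ≡ᵇ x in c≡x
... | true  = ⊥-elim (x∉ (here (sym (≡ᵇ⇒≡ c x (Equivalence.from T-≡ c≡x)))))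
... | false rewrite breakAt-++ x u t (x∉ ∘ there) = refl

spanLt-All< : ∀ x B → All (_< x) B → spanLt x B ≡ (B , [])
spanLt-All< x []      []          = refl
spanLt-All< x (b ∷ B) (b<x ∷ B<x) rewrite <⇒<ᵇ≡true b<x | spanLt-All< x B B<x = refl

spanLt-head> : ∀ x L → Below (head L) x → spanLt x L ≡ ([] , L)
spanLt-head> x []      _   = refl
spanLt-head> x (y ∷ L) x<y rewrite >⇒<ᵇ≡false (<ᵇ≡true⇒< x y x<y) = refl

phi'-split : ∀ P x b B → x ∉ P → All (_< x) (b ∷ B) → BelowLast nothing P x →
             phi' x (P ++ x ∷ b ∷ B) ≡ P ++ (b ∷ B) ++ [ x ]
phi'-split P x b B x∉P B<x@(b<x ∷ _) x<last
  rewrite breakAt-++ x P (b ∷ B) x∉P | spanLt-All< x (b ∷ B) B<x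
        | spanLt-head> x (reverse P) (BelowLast⇒Below-head-reverse P x<last)
        | BelowLast⇒Below-head-reverse P x<last
        | <⇒<ᵇ≡true b<x | >⇒<ᵇ≡false b<x | ∧-zeroʳ (ltE (head (reverse P)) (just x))
        | reverse-involutive P = refl

data MaxPosition (w : List ℕ) (x : ℕ) (r : List ℕ) : Set where
  max-at     : w ≡ x ∷ r → maxList w ≡ x → MaxPosition w x r
  max-before : ∀ u A → w ≡ u ++ maxList w ∷ A ++ x ∷ r → x < maxList w →
               BelowLast (just (maxList w)) A x → MaxPosition w x r

maxPosition : ∀ {w} q A x r → w ≡ A ++ x ∷ r → All (_< x) r → BelowLast q A x → MaxPosition w x r
maxPosition q []      x r refl r<x _ = max-at refl (maxList-∷-greatest r r<x)
maxPosition q (a ∷ A) x r refl r<x x<last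
  with BelowLast-∷⇒∃> {q} a A x<last | ∈-++⁻ (a ∷ A) (maxList-∈ a (A ++ x ∷ r))
... | c , c∈ , x<c | m∈ = locate m∈
  where
  w : List ℕ
  w = a ∷ A ++ x ∷ r
  x<m : x < maxList w
  x<m = <-≤-trans x<c (All.lookup (maxList-ub w) (∈-++⁺ˡ c∈))
  locate : maxList w ∈ a ∷ A ⊎ maxList w ∈ x ∷ r → MaxPosition w x r
  locate (inj₂ (here m≡x))  = ⊥-elim (<-irrefl (sym m≡x) x<m)
  locate (inj₂ (there m∈r)) = ⊥-elim (<-asym x<m (All.lookup r<x m∈r))
  locate (inj₁ m∈aA) with ∈-∃++ m∈aA
  ... | u , A₂ , aA≡ =
    max-before u A₂ (trans (cong (_++ x ∷ r) aA≡) (++-assoc u (maxList w ∷ A₂) (x ∷ r))) x<m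
      (subst (λ t → Below t x) (trans (cong (lastOr q) aA≡) (lastOr-++ q u (maxList w ∷ A₂))) x<last)

rixCase-++-∷ : ∀ (r : List ℕ → ℕ) u A x t → r (A ++ x ∷ t) ≡ 0 → rixCase r u (A ++ x ∷ t) ≡ 0
rixCase-++-∷ r []      []      x t _   = refl
rixCase-++-∷ r []      (_ ∷ _) x t _   = refl
rixCase-++-∷ r (_ ∷ _) []      x t r≡0 = r≡0
rixCase-++-∷ r (_ ∷ _) (_ ∷ _) x t r≡0 = r≡0

-- Running out of fuel also yields 0, so no length bound is needed.
rixF-split : ∀ fuel w q A x b B → Unique w → w ≡ A ++ x ∷ b ∷ B →
             All (_< x) (b ∷ B) → BelowLast q A x → rixF fuel w ≡ 0
rixF-split zero       w        q A x b B _  _  _   _      = refl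
rixF-split (suc fuel) []       q A x b B _  _  _   _      = refl
rixF-split (suc fuel) (y ∷ ys) q A x b B uw w≡ B<x x<last
  with maxPosition q A x (b ∷ B) w≡ B<x x<last
... | max-at w≡x∷ m≡x rewrite trans (cong₂ breakAt m≡x w≡x∷) (breakAt-++ x [] (b ∷ B) λ ()) = refl
... | max-before u A₂ w≡u∷ _ x<last′
  rewrite trans (cong (breakAt (maxList (y ∷ ys))) w≡u∷)
                (breakAt-++ _ u (A₂ ++ x ∷ b ∷ B) (Unique-middle∉ˡ u (subst Unique w≡u∷ uw))) =
  rixCase-++-∷ (rixF fuel) u A₂ x (b ∷ B)
    (rixF-split fuel _ _ A₂ x b B (Unique-suffix u (subst Unique w≡u∷ uw)) refl B<x x<last′)

rixF≡0⇒DescentSplit : ∀ fuel y ys → length (y ∷ ys) ≤ fuel → Unique (y ∷ ys) →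
                      rixF fuel (y ∷ ys) ≡ 0 → DescentSplit (y ∷ ys)
rixF≡0⇒DescentSplit (suc fuel) y ys len uw rix≡0 with ∈-∃++ (maxList-∈ y ys)
... | u , z , w≡ = fromCase u z w≡ (subst (λ (u , z) → rixCase (rixF fuel) u z ≡ 0) breakAt≡ rix≡0)
  where
  mx : ℕ
  mx = maxList (y ∷ ys)
  breakAt≡ : breakAt mx (y ∷ ys) ≡ (u , z)
  breakAt≡ = trans (cong (breakAt mx) w≡) (breakAt-++ mx u z (Unique-middle∉ˡ u (subst Unique w≡ uw)))
  z<mx : ∀ u {z} → y ∷ ys ≡ u ++ mx ∷ z → All (_< mx) z
  z<mx u w≡ = suffix-<-max u w≡ (maxList-ub (y ∷ ys)) uw
  fromCase : ∀ u z → y ∷ ys ≡ u ++ mx ∷ z → rixCase (rixF fuel) u z ≡ 0 → DescentSplit (y ∷ ys)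
  fromCase []      (c ∷ z) w≡ _ = split [] mx c z w≡ (z<mx [] w≡) refl
  fromCase (a ∷ u) (c ∷ z) w≡ rix≡0
    with rixF≡0⇒DescentSplit fuel c z (length-suffix-≤ (a ∷ u) w≡ len)
                             (Unique-suffix (a ∷ u) (subst Unique w≡ uw)) rix≡0
  ... | split P x b B z≡ B<x x<last = split (a ∷ u ++ mx ∷ P) x b B w≡P++ B<x x<lastP
    where
    w≡P++ : y ∷ ys ≡ (a ∷ u ++ mx ∷ P) ++ x ∷ b ∷ B
    w≡P++ = trans w≡ (trans (cong (λ t → a ∷ u ++ mx ∷ t) z≡) (sym (++-assoc (a ∷ u) (mx ∷ P) (x ∷ b ∷ B))))
    x<mx : Below (just mx) x
    x<mx = <⇒<ᵇ≡true (All.lookup (z<mx (a ∷ u) w≡) (subst (x ∈_) (sym z≡) (∈-++⁺ʳ P (here refl))))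
    x<lastP : BelowLast nothing (a ∷ u ++ mx ∷ P) x
    x<lastP = subst (λ t → Below t x) (sym (lastOr-++ nothing (a ∷ u) (mx ∷ P))) (BelowLast-rebase P x<last x<mx)

descTops-All : ∀ {P : ℕ → Set} w → All P w → All P (descTops w)
descTops-All []           _          = []
descTops-All (_ ∷ [])     _          = []
descTops-All (x ∷ y ∷ xs) (px ∷ pxs) with y <ᵇ x
... | true  = px ∷ descTops-All (y ∷ xs) pxs
... | false = descTops-All (y ∷ xs) pxs

descTops-∷-⊇ : ∀ y t {e} → e ∈ descTops t → e ∈ descTops (y ∷ t)
descTops-∷-⊇ y (z ∷ t) e∈ with z <ᵇ y
... | true  = there e∈
... | false = e∈

descTops-∋ : ∀ u m A y r → All (_< m) (A ++ y ∷ r) → m ∈ descTops (u ++ m ∷ A ++ y ∷ r)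
descTops-∋ []      m []      y r (y<m ∷ _) rewrite <⇒<ᵇ≡true y<m = here refl
descTops-∋ []      m (a ∷ A) y r (a<m ∷ _) rewrite <⇒<ᵇ≡true a<m = here refl
descTops-∋ (c ∷ u) m A       y r A<m = descTops-∷-⊇ c (u ++ m ∷ A ++ y ∷ r) (descTops-∋ u m A y r A<m)

maxList-descTops : ∀ {w} u m A y r → w ≡ u ++ m ∷ A ++ y ∷ r → All (_< m) (A ++ y ∷ r) →
                   All (_≤ m) w → maxList (descTops w) ≡ m
maxList-descTops {w} u m A y r refl A<m w≤m =
  ≤-antisym (maxList-lub (descTops w) (descTops-All w w≤m))
            (All.lookup (maxList-ub (descTops w)) (descTops-∋ u m A y r A<m))

betaF-split : ∀ fuel w p A x b B → length w ≤ fuel → Unique w → w ≡ A ++ x ∷ b ∷ B →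
              All (_< x) (b ∷ B) → BelowLast p A x → ddGo p w ≡ 1 → All (Below p) w →
              betaF fuel w ≡ x ∷ b ∷ B
betaF-split zero w p []      x b B () _ refl _ _ _ _
betaF-split zero w p (_ ∷ _) x b B () _ refl _ _ _ _
betaF-split (suc fuel) w p A x b B len uw w≡ B<x@(b<x ∷ _) x<last dd≡1 w<p
  with increasing w | trans (cong increasing w≡) (increasing-descent A x b B b<x)
... | true  | ()
... | false | _ with maxPosition p A x (b ∷ B) w≡ B<x x<last
...   | max-at w≡x∷ m≡x
  rewrite maxList-descTops [] (maxList w) [] b B (trans w≡x∷ (cong (λ t → t ∷ b ∷ B) (sym m≡x)))
                           (subst (λ t → All (_< t) (b ∷ B)) (sym m≡x) B<x) (maxList-ub w)
        | trans (cong₂ breakAt m≡x w≡x∷) (breakAt-++ x [] (b ∷ B) λ ()) = w≡x∷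
-- The maximum cannot be the first letter: it would be a second double descent.
...   | max-before [] A₂ w≡m∷ _ x<last′ =
  ⊥-elim (<-irrefl refl (subst (2 ≤_) (trans (cong (ddGo p) (sym w≡m∷)) dd≡1) two≤))
  where
  two≤ : 2 ≤ ddGo p (maxList w ∷ A₂ ++ x ∷ b ∷ B)
  two≤ = ddGo-two-doubleDescents p (maxList w) A₂ x b B
           (All.lookup w<p (subst (maxList w ∈_) (sym w≡m∷) (here refl)))
           (suffix-<-max [] w≡m∷ (maxList-ub w) uw) B<x x<last′
...   | max-before (a ∷ u) A₂ w≡u∷ _ x<last′
  rewrite maxList-descTops (a ∷ u) (maxList w) A₂ x (b ∷ B) w≡u∷
            (suffix-<-max (a ∷ u) w≡u∷ (maxList-ub w) uw) (maxList-ub w)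
        | trans (cong (breakAt (maxList w)) w≡u∷)
                (breakAt-++ _ (a ∷ u) (A₂ ++ x ∷ b ∷ B) (Unique-middle∉ˡ (a ∷ u) (subst Unique w≡u∷ uw))) =
  betaF-split fuel z (just (maxList w)) A₂ x b B
    (length-suffix-≤ (a ∷ u) w≡u∷ len)
    (Unique-suffix (a ∷ u) (subst Unique w≡u∷ uw)) refl B<x x<last′
    (≤-antisym (subst (ddGo (just (maxList w)) z ≤_) (trans (cong (ddGo p) (sym w≡u∷)) dd≡1)
                      (ddGo-suffix-≤ p (a ∷ u) (maxList w) z))
               (ddGo-split-pos (just (maxList w)) A₂ x b B B<x x<last′))
    (All.map <⇒<ᵇ≡true (suffix-<-max (a ∷ u) w≡u∷ (maxList-ub w) uw))
  where
  z : List ℕ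
  z = A₂ ++ x ∷ b ∷ B

f-split : ∀ P x b B → Unique (P ++ x ∷ b ∷ B) → dd (P ++ x ∷ b ∷ B) ≡ 1 →
          All (_< x) (b ∷ B) → BelowLast nothing P x → f (P ++ x ∷ b ∷ B) ≡ P ++ (b ∷ B) ++ [ x ]
f-split P x b B uσ dd≡1 B<x x<last =
  trans (cong (λ β → phi' (fromMaybe 0 (head β)) σ)
              (betaF-split (length σ) σ nothing P x b B ≤-refl uσ refl B<x x<last dd≡1
                           (All.tabulate λ _ → refl)))
        (phi'-split P x b B (Unique-middle∉ˡ P uσ) B<x x<last)
  where
  σ : List ℕ
  σ = P ++ x ∷ b ∷ B

R0⇒DescentSplit : ∀ {k σ} → R0 n k σ → DescentSplit σ
R0⇒DescentSplit {σ = []}     (_  , _     , () , _)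
R0⇒DescentSplit {σ = y ∷ ys} (σ↭ , rix≡0 , _  , _) =
  rixF≡0⇒DescentSplit _ y ys ≤-refl (IsPerm⇒Unique σ↭) rix≡0

Dt-moveToEnd : ∀ n P x b B → All (_< x) (b ∷ B) → BelowLast nothing P x →
               IsPerm n (P ++ x ∷ b ∷ B) → dd (P ++ x ∷ b ∷ B) ≡ 1 →
               Dt n (des (P ++ x ∷ b ∷ B)) (P ++ (b ∷ B) ++ [ x ])
Dt-moveToEnd n P x b B B<x x<last σ↭ dd≡1 rewrite des-split nothing P x b B B<x x<last =
  (Perm.↭-trans (↭-sym (↭-moveToEnd P x b B)) σ↭ ,
   suc-injective (trans (sym (ddGo-split nothing P x b B B<x x<last)) dd≡1) , refl) ,
  lastAsc-split P x b B B<x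

f-maps-R0-to-Dt : ∀ n k σ → R0 n k σ → Dt n k (f σ)
f-maps-R0-to-Dt n k σ r0@(σ↭ , _ , dd≡1 , des≡k) with R0⇒DescentSplit r0
... | split P x b B refl B<x x<last =
  subst₂ (Dt n) des≡k (sym (f-split P x b B (IsPerm⇒Unique σ↭) dd≡1 B<x x<last))
         (Dt-moveToEnd n P x b B B<x x<last σ↭ dd≡1)

moveToEnd-injective : ∀ P x b B P′ x′ b′ B′ → All (_< x) (b ∷ B) → All (_< x′) (b′ ∷ B′) →
                      BelowLast nothing P x → BelowLast nothing P′ x′ →
                      P ++ (b ∷ B) ++ [ x ] ≡ P′ ++ (b′ ∷ B′) ++ [ x′ ] →
                      P ++ x ∷ b ∷ B ≡ P′ ++ x′ ∷ b′ ∷ B′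
moveToEnd-injective P x b B P′ x′ b′ B′ B<x B′<x′ x<last x′<last′ moved≡
  with ∷ʳ-injective (P ++ b ∷ B) (P′ ++ b′ ∷ B′)
         (trans (++-assoc P (b ∷ B) [ x ]) (trans moved≡ (sym (++-assoc P′ (b′ ∷ B′) [ x′ ]))))
... | PbB≡ , refl with split-unique nothing P P′ (b ∷ B) (b′ ∷ B′) PbB≡ B<x B′<x′ x<last x′<last′
... | refl , refl = refl

f-injective-on-R0 : ∀ n k σ τ → R0 n k σ → R0 n k τ → f σ ≡ f τ → σ ≡ τ
f-injective-on-R0 n k σ τ r0σ@(σ↭ , _ , ddσ≡1 , _) r0τ@(τ↭ , _ , ddτ≡1 , _) fσ≡fτ
  with R0⇒DescentSplit r0σ | R0⇒DescentSplit r0τ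
... | split P x b B refl B<x x<last | split P′ x′ b′ B′ refl B′<x′ x′<last′ =
  moveToEnd-injective P x b B P′ x′ b′ B′ B<x B′<x′ x<last x′<last′ (begin
    P ++ (b ∷ B) ++ [ x ]     ≡⟨ f-split P x b B (IsPerm⇒Unique σ↭) ddσ≡1 B<x x<last ⟨
    f (P ++ x ∷ b ∷ B)        ≡⟨ fσ≡fτ ⟩
    f (P′ ++ x′ ∷ b′ ∷ B′)    ≡⟨ f-split P′ x′ b′ B′ (IsPerm⇒Unique τ↭) ddτ≡1 B′<x′ x′<last′ ⟩
    P′ ++ (b′ ∷ B′) ++ [ x′ ] ∎)
  where open ≡-Reasoning

R0-preimage : ∀ n k P x b B → All (_< x) (b ∷ B) → BelowLast nothing P x →
              D n k (P ++ (b ∷ B) ++ [ x ]) →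
              R0 n (suc k) (P ++ x ∷ b ∷ B) × f (P ++ x ∷ b ∷ B) ≡ P ++ (b ∷ B) ++ [ x ]
R0-preimage n k P x b B B<x x<last (τ↭ , dd≡0 , des≡k) =
  (σ↭ , rixF-split (length σ) σ nothing P x b B uσ refl B<x x<last , dd≡1 ,
   trans (des-split nothing P x b B B<x x<last) (cong suc des≡k)) ,
  f-split P x b B uσ dd≡1 B<x x<last
  where
  σ : List ℕ
  σ = P ++ x ∷ b ∷ B
  σ↭ : IsPerm n σ
  σ↭ = Perm.↭-trans (↭-moveToEnd P x b B) τ↭
  uσ : Unique σ
  uσ = IsPerm⇒Unique σ↭
  dd≡1 : dd σ ≡ 1
  dd≡1 = trans (ddGo-split nothing P x b B B<x x<last) (cong suc dd≡0)

f-onto-Dt : ∀ n k τ → Dt n k τ → ∃ λ σ → R0 n k σ × f σ ≡ τ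
f-onto-Dt n zero    τ (_ , ())
f-onto-Dt n (suc k) τ (dτ@(τ↭ , _) , asc) with initLast τ | asc
... | []      | ()
... | I ∷ʳ′ x | _ with maximal-suffix< x I (Unique-middle∉ˡ I (IsPerm⇒Unique τ↭))
...   | P , []    , refl , _   , x<last =
  ⊥-elim (lastAsc-snoc-BelowLast-⊥ P (subst (λ t → lastAsc (t ++ [ x ]) ≡ true) (++-identityʳ P) asc)
                                    x<last)
...   | P , b ∷ B , refl , B<x , x<last =
  P ++ x ∷ b ∷ B ,
  subst (λ τ → R0 n (suc k) (P ++ x ∷ b ∷ B) × f (P ++ x ∷ b ∷ B) ≡ τ)
        (sym (++-assoc P (b ∷ B) [ x ]))
    (R0-preimage n k P x b B B<x x<last (subst (D n k) (++-assoc P (b ∷ B) [ x ]) dτ))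

corollary3p6 : (n k : ℕ) →
    ((σ : List ℕ) → R0 n k σ → Dt n k (f σ)) ×
    ((σ τ : List ℕ) → R0 n k σ → R0 n k τ → f σ ≡ f τ → σ ≡ τ) ×
    ((τ : List ℕ) → Dt n k τ → ∃ λ σ → R0 n k σ × f σ ≡ τ)
corollary3p6 n k = f-maps-R0-to-Dt n k , f-injective-on-R0 n k , f-onto-Dt n k
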